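{- Let $F_n$ be the friendship graph with $n\geq 2$. Then $\gamma(C(F_n))=n+1$.
   Context: The friendship graph $F_n$ of order $2n+1$ is obtained from $n$ disjoint copies of the triangle $K_3$ by identifying one vertex of each triangle into a single common vertex. The central graph $C(G)$ of a simple graph $G$ is obtained from $G$ by subdividing each edge of $G$ exactly once and joining every pair of vertices non-adjacent in $G$ by an edge. $\gamma$ denotes the domination number. -}

module Defs where

open import Data.Nat using (ℕ; zero; suc; _+_; _*_; _<_; _≤_)
open import Data.Nat.Properties using (_≟_)
open import Data.Nat.DivMod using (_/_)
open import Data.Fin using (Fin; toℕ)
import Data.Fin as F
open import Data.Bool using (Bool; true; false; _∧_; _∨_; not)
open import Data.Sum using (_⊎_; inj₁; inj₂)
open import Data.Product using (Σ; ∃; _×_; _,_)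
open import Data.List using (List; length)
open import Data.List.Membership.Propositional using (_∈_)
open import Data.List.Relation.Unary.Unique.Propositional using (Unique)
open import Relation.Nullary using (¬_)
open import Data.Empty using (⊥)
open import Relation.Nullary.Decidable using (⌊_⌋)
open import Relation.Binary.PropositionalEquality using (_≡_; _≢_)

record Graph : Set₁ where
  field
    V   : Set
    Adj : V → V → Set
open Graph public

-- A simple graph on vertex set Fin m, given by a Bool-valued adjacency
-- (intended to be symmetric and irreflexive).
record SimpleGraph (m : ℕ) : Set where
  field
    adj : Fin m → Fin m → Bool
open SimpleGraph public

-- Friendship graph F_n on vertices 0 .. 2n : vertex 0 is the common
-- centre, and for each i < n the triangle is {0, 2i+1, 2i+2}.
friendAdjℕ : ℕ → ℕ → Bool
friendAdjℕ zero zero = false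
friendAdjℕ zero (suc y) = true
friendAdjℕ (suc x) zero = true
friendAdjℕ (suc x) (suc y) = not ⌊ x ≟ y ⌋ ∧ ⌊ x / 2 ≟ y / 2 ⌋

friendship : (n : ℕ) → SimpleGraph (suc (2 * n))
friendship n = record { adj = λ x y → friendAdjℕ (toℕ x) (toℕ y) }

record Edge {m : ℕ} (G : SimpleGraph m) : Set where
  constructor edge
  field
    u   : Fin m
    v   : Fin m
    u<v : u F.< v
    uv  : adj G u v ≡ true
open Edge public

CAdj : {m : ℕ} (G : SimpleGraph m) → Fin m ⊎ Edge G → Fin m ⊎ Edge G → Set
CAdj G (inj₁ x) (inj₁ y) = (x ≢ y) × (adj G x y ≡ false)
CAdj G (inj₁ x) (inj₂ e) = (x ≡ u e) ⊎ (x ≡ v e)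
CAdj G (inj₂ e) (inj₁ x) = (x ≡ u e) ⊎ (x ≡ v e)
CAdj G (inj₂ e) (inj₂ f) = ⊥

central : {m : ℕ} → SimpleGraph m → Graph
central {m} G = record { V = Fin m ⊎ Edge G ; Adj = CAdj G }

Dominating : (G : Graph) → List (V G) → Set
Dominating G D = ∀ w → (w ∈ D) ⊎ Σ (V G) (λ d → (d ∈ D) × Adj G d w)

DominationNumber : Graph → ℕ → Set
DominationNumber G k =
  Σ (List (V G)) (λ D → Unique D × Dominating G D × length D ≡ k)
  × (∀ (D : List (V G)) → Dominating G D → k ≤ length D)

{-# OPTIONS --safe #-}
module Submission where

-- The centre together with the vertex 2i+1 of every triangle dominates C(F_n): the
-- centre dominates the subdivision vertices of its spokes, 2i+1 that of the outer edge
-- {2i+1, 2i+2}, and 2i+2 is adjacent in C(F_n) to 2j+1 for any j ≠ i, which exists as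
-- n ≥ 2. Conversely the centre and the n subdivision vertices of the outer edges have
-- pairwise disjoint closed neighbourhoods, so every dominating set has n + 1 vertices.

open import Defs
open import Data.Nat using (ℕ; zero; suc; _+_; _*_; _<_; _≤_; s≤s; s≤s⁻¹)
open import Data.Nat.Properties
open import Data.Nat.DivMod using (_/_; _%_; m*n/n≡m; m*n%n≡0; +-distrib-/; /-monoˡ-≤)
open import Data.Fin using (Fin; toℕ; fromℕ<; punchIn)
import Data.Fin as F
open import Data.Fin.Properties using (toℕ-fromℕ<; toℕ-injective; toℕ<n; punchInᵢ≢i; injective⇒≤)
open import Data.Bool using (true; false; not; _∧_)
open import Data.Bool.Properties using (∧-zeroʳ; ∧-conicalʳ; T-≡)
open import Data.Sum using (_⊎_; inj₁; inj₂)
open import Data.Sum.Properties using (inj₁-injective)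
open import Data.Product using (∃; _,_)
open import Data.List using (List; length; lookup; tabulate)
open import Data.List.Properties using (length-tabulate)
open import Data.List.Membership.Propositional using (_∈_)
open import Data.List.Membership.Propositional.Properties using (∈-tabulate⁺)
open import Data.List.Relation.Unary.Any as Any using (Any)
open import Data.List.Relation.Unary.Any.Properties using (lookup-index)
open import Data.List.Relation.Unary.Unique.Propositional.Properties using (tabulate⁺)
open import Data.Empty using (⊥-elim)
open import Function using (_∘_; Equivalence)
open import Relation.Nullary using (¬_; Dec; contradiction)
open import Relation.Nullary.Decidable using (⌊_⌋; isYes≗does; dec-true; dec-false; toWitness)
open import Relation.Binary.PropositionalEquality

distinct-element : ∀ {n} → 2 ≤ n → (i : Fin n) → ∃ λ j → j ≢ i
distinct-element (s≤s (s≤s _)) i = punchIn i F.zero , punchInᵢ≢i i F.zero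

onto-Fin⇒≤-length : ∀ {a} {A : Set a} {m} (c : A → ℕ) (xs : List A) →
                         (∀ (k : Fin m) → Any (λ x → c x ≡ toℕ k) xs) → m ≤ length xs
onto-Fin⇒≤-length c xs hit = injective⇒≤ index-injective
  where
  index-injective : ∀ {k l} → Any.index (hit k) ≡ Any.index (hit l) → k ≡ l
  index-injective {k} {l} eq = toℕ-injective (begin
    toℕ k                           ≡⟨ sym (lookup-index (hit k)) ⟩
    c (lookup xs (Any.index (hit k))) ≡⟨ cong (c ∘ lookup xs) eq ⟩
    c (lookup xs (Any.index (hit l))) ≡⟨ lookup-index (hit l) ⟩
    toℕ l                           ∎)
    where open ≡-Reasoning

-- If the closed neighbourhoods of w k are pairwise disjoint (c separates them),
-- each must contain its own vertex of a dominating set.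
packing≤dominating : (G : Graph) {m : ℕ} (w : Fin m → V G) (c : V G → ℕ) →
                     (∀ k d → d ≡ w k ⊎ Adj G d (w k) → c d ≡ toℕ k) →
                     ∀ D → Dominating G D → m ≤ length D
packing≤dominating G w c closed D dom = onto-Fin⇒≤-length c D hit
  where
  hit : ∀ k → Any (λ d → c d ≡ toℕ k) D
  hit k with dom (w k)
  ... | inj₁ wk∈D            = Any.map (λ { refl → closed k (w k) (inj₁ refl) }) wk∈D
  ... | inj₂ (d , d∈D , adj) = Any.map (λ { refl → closed k d (inj₂ adj) }) d∈D

half-double : ∀ i → i * 2 / 2 ≡ i
half-double i = m*n/n≡m i 2

half-suc-double : ∀ i → (1 + i * 2) / 2 ≡ i
half-suc-double i = trans (+-distrib-/ 1 (i * 2) remainders<2) (half-double i)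
  where
  remainders<2 : 1 % 2 + i * 2 % 2 < 2
  remainders<2 = subst (λ r → 1 + r < 2) (sym (m*n%n≡0 i 2)) ≤-refl

i<n⇒2+i*2≤2*n : ∀ {i n} → i < n → 2 + i * 2 ≤ 2 * n
i<n⇒2+i*2≤2*n {i} {n} i<n = subst (2 + i * 2 ≤_) (*-comm n 2) (*-monoˡ-≤ 2 i<n)

1+i*2<1+2*n⇒i<n : ∀ {i n} → 1 + i * 2 < 1 + 2 * n → i < n
1+i*2<1+2*n⇒i<n {i} {n} lt = *-cancelʳ-< 2 i n (subst (i * 2 <_) (*-comm 2 n) (s≤s⁻¹ lt))

data ParityView : ℕ → Set where
  zero : ParityView 0
  odd  : ∀ i → ParityView (1 + i * 2)
  even : ∀ i → ParityView (2 + i * 2)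

parityView : ∀ x → ParityView x
parityView zero = zero
parityView (suc zero) = odd 0
parityView (suc (suc x)) with parityView x
... | zero   = even 0
... | odd i  = odd (suc i)
... | even i = even (suc i)

-- Vertex 0 gets class 0 and the outer vertices 2i+1, 2i+2 of triangle i get class 1+i.
triangle : ℕ → ℕ
triangle zero    = zero
triangle (suc y) = suc (y / 2)

⌊⌋≡true : ∀ {a} {A : Set a} (a? : Dec A) → A → ⌊ a? ⌋ ≡ true
⌊⌋≡true a? a = trans (isYes≗does a?) (dec-true a? a)

⌊⌋≡false : ∀ {a} {A : Set a} (a? : Dec A) → ¬ A → ⌊ a? ⌋ ≡ false
⌊⌋≡false a? ¬a = trans (isYes≗does a?) (dec-false a? ¬a)

friendAdjℕ-same-triangle : ∀ a b → a ≢ b → a / 2 ≡ b / 2 → friendAdjℕ (suc a) (suc b) ≡ true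
friendAdjℕ-same-triangle a b a≢b same =
  cong₂ (λ equal sameHalf → not equal ∧ sameHalf) (⌊⌋≡false (a ≟ b) a≢b) (⌊⌋≡true (a / 2 ≟ b / 2) same)

friendAdjℕ-other-triangle : ∀ a b → a / 2 ≢ b / 2 → friendAdjℕ (suc a) (suc b) ≡ false
friendAdjℕ-other-triangle a b differ =
  trans (cong (not ⌊ a ≟ b ⌋ ∧_) (⌊⌋≡false (a / 2 ≟ b / 2) differ)) (∧-zeroʳ (not ⌊ a ≟ b ⌋))

friendAdjℕ⇒same-triangle : ∀ a b → friendAdjℕ (suc a) (suc b) ≡ true → a / 2 ≡ b / 2
friendAdjℕ⇒same-triangle a b adj =
  toWitness (Equivalence.from T-≡ (∧-conicalʳ (not ⌊ a ≟ b ⌋) _ adj))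

friendAdjℕ-even-maximal : ∀ i b → 2 + i * 2 < b → friendAdjℕ (2 + i * 2) b ≢ true
friendAdjℕ-even-maximal i (suc b) (s≤s 2+i*2≤b) adj = 1+n≰n (begin
  suc i             ≡⟨ sym (half-double (suc i)) ⟩
  (2 + i * 2) / 2   ≤⟨ /-monoˡ-≤ 2 2+i*2≤b ⟩
  b / 2             ≡⟨ sym (friendAdjℕ⇒same-triangle (1 + i * 2) b adj) ⟩
  (1 + i * 2) / 2   ≡⟨ half-suc-double i ⟩
  i                 ∎)
  where open ≤-Reasoning

module FriendshipCentral (n : ℕ) where

  G : SimpleGraph (suc (2 * n))
  G = friendship n

  centre : Fin (suc (2 * n))
  centre = F.zero

  tip₁-bound : (i : Fin n) → 1 + toℕ i * 2 < suc (2 * n)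
  tip₁-bound i = s≤s (<⇒≤ (i<n⇒2+i*2≤2*n (toℕ<n i)))

  tip₂-bound : (i : Fin n) → 2 + toℕ i * 2 < suc (2 * n)
  tip₂-bound i = s≤s (i<n⇒2+i*2≤2*n (toℕ<n i))

  tip₁ tip₂ : Fin n → Fin (suc (2 * n))
  tip₁ i = fromℕ< (tip₁-bound i)
  tip₂ i = fromℕ< (tip₂-bound i)

  toℕ-tip₁ : ∀ i → toℕ (tip₁ i) ≡ 1 + toℕ i * 2
  toℕ-tip₁ i = toℕ-fromℕ< (tip₁-bound i)

  toℕ-tip₂ : ∀ i → toℕ (tip₂ i) ≡ 2 + toℕ i * 2
  toℕ-tip₂ i = toℕ-fromℕ< (tip₂-bound i)

  triangle-tip₁ : ∀ i → triangle (toℕ (tip₁ i)) ≡ suc (toℕ i)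
  triangle-tip₁ i = trans (cong triangle (toℕ-tip₁ i)) (cong suc (half-double (toℕ i)))

  triangle-tip₂ : ∀ i → triangle (toℕ (tip₂ i)) ≡ suc (toℕ i)
  triangle-tip₂ i = trans (cong triangle (toℕ-tip₂ i)) (cong suc (half-suc-double (toℕ i)))

  anchor : Fin (suc n) → Fin (suc (2 * n))
  anchor F.zero    = centre
  anchor (F.suc i) = tip₁ i

  triangle-anchor : ∀ k → triangle (toℕ (anchor k)) ≡ toℕ k
  triangle-anchor F.zero    = refl
  triangle-anchor (F.suc i) = triangle-tip₁ i

  anchor-injective : ∀ {k l} → anchor k ≡ anchor l → k ≡ l
  anchor-injective {k} {l} eq = toℕ-injective
    (trans (sym (triangle-anchor k)) (trans (cong (triangle ∘ toℕ) eq) (triangle-anchor l)))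

  tip₁≢tip₂ : ∀ {i j} → j ≢ i → tip₁ j ≢ tip₂ i
  tip₁≢tip₂ {i} {j} j≢i eq = j≢i (toℕ-injective (suc-injective
    (trans (sym (triangle-tip₁ j)) (trans (cong (triangle ∘ toℕ) eq) (triangle-tip₂ i)))))

  adj-tips : ∀ j i → adj G (tip₁ j) (tip₂ i) ≡ friendAdjℕ (1 + toℕ j * 2) (2 + toℕ i * 2)
  adj-tips j i = cong₂ friendAdjℕ (toℕ-tip₁ j) (toℕ-tip₂ i)

  tip₁-tip₂-nonadjacent : ∀ {i j} → j ≢ i → adj G (tip₁ j) (tip₂ i) ≡ false
  tip₁-tip₂-nonadjacent {i} {j} j≢i = trans (adj-tips j i)
    (friendAdjℕ-other-triangle (toℕ j * 2) (1 + toℕ i * 2) λ same →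
      j≢i (toℕ-injective (trans (sym (half-double (toℕ j))) (trans same (half-suc-double (toℕ i))))))

  tips-adjacent : ∀ i → adj G (tip₁ i) (tip₂ i) ≡ true
  tips-adjacent i = trans (adj-tips i i)
    (friendAdjℕ-same-triangle (toℕ i * 2) (1 + toℕ i * 2) (<⇒≢ (n<1+n (toℕ i * 2)))
      (trans (half-double (toℕ i)) (sym (half-suc-double (toℕ i)))))

  tip₂-maximal : ∀ i {y} → tip₂ i F.< y → adj G (tip₂ i) y ≢ true
  tip₂-maximal i {y} lt adjacent = friendAdjℕ-even-maximal (toℕ i) (toℕ y)
    (subst (_< toℕ y) (toℕ-tip₂ i) lt)
    (trans (cong (λ t → friendAdjℕ t (toℕ y)) (sym (toℕ-tip₂ i))) adjacent)

  blade : Fin n → Edge G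
  blade i = edge (tip₁ i) (tip₂ i) (subst₂ _<_ (sym (toℕ-tip₁ i)) (sym (toℕ-tip₂ i)) ≤-refl)
                 (tips-adjacent i)

  data Place (x : Fin (suc (2 * n))) : Set where
    at-anchor : ∀ k → x ≡ anchor k → Place x
    at-tip₂   : ∀ i → x ≡ tip₂ i → Place x

  place : ∀ x → Place x
  place x = fromParity (parityView (toℕ x)) refl
    where
    fromParity : ∀ {m} → ParityView m → toℕ x ≡ m → Place x
    fromParity zero     eq = at-anchor F.zero (toℕ-injective eq)
    fromParity (odd i)  eq = at-anchor (F.suc j) (toℕ-injective (begin
      toℕ x           ≡⟨ eq ⟩
      1 + i * 2       ≡⟨ cong (λ t → 1 + t * 2) (sym (toℕ-fromℕ< i<n)) ⟩
      1 + toℕ j * 2   ≡⟨ sym (toℕ-tip₁ j) ⟩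
      toℕ (tip₁ j)    ∎))
      where
      open ≡-Reasoning
      i<n : i < n
      i<n = 1+i*2<1+2*n⇒i<n (subst (_< suc (2 * n)) eq (toℕ<n x))
      j : Fin n
      j = fromℕ< i<n
    fromParity (even i) eq = at-tip₂ j (toℕ-injective (begin
      toℕ x           ≡⟨ eq ⟩
      2 + i * 2       ≡⟨ cong (λ t → 2 + t * 2) (sym (toℕ-fromℕ< i<n)) ⟩
      2 + toℕ j * 2   ≡⟨ sym (toℕ-tip₂ j) ⟩
      toℕ (tip₂ j)    ∎))
      where
      open ≡-Reasoning
      i<n : i < n
      i<n = 1+i*2<1+2*n⇒i<n (<-trans ≤-refl (subst (_< suc (2 * n)) eq (toℕ<n x)))
      j : Fin n
      j = fromℕ< i<n

  anchors : List (V (central G))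
  anchors = tabulate (inj₁ ∘ anchor)

  anchor∈anchors : ∀ k → inj₁ (anchor k) ∈ anchors
  anchor∈anchors = ∈-tabulate⁺ {f = inj₁ ∘ anchor}

  anchors-dominate : 2 ≤ n → Dominating (central G) anchors
  anchors-dominate 2≤n (inj₁ x) with place x
  ... | at-anchor k refl = inj₁ (anchor∈anchors k)
  ... | at-tip₂ i refl with distinct-element 2≤n i
  ...   | j , j≢i = inj₂ (inj₁ (tip₁ j) , anchor∈anchors (F.suc j) , tip₁≢tip₂ j≢i , tip₁-tip₂-nonadjacent j≢i)
  anchors-dominate _ (inj₂ (edge x y x<y xy)) with place x
  ... | at-anchor k refl = inj₂ (inj₁ (anchor k) , anchor∈anchors k , inj₁ refl)
  ... | at-tip₂ i refl = ⊥-elim (tip₂-maximal i x<y xy)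

  packing : Fin (suc n) → V (central G)
  packing F.zero    = inj₁ centre
  packing (F.suc i) = inj₂ (blade i)

  class : V (central G) → ℕ
  class (inj₁ x) = triangle (toℕ x)
  class (inj₂ e) = triangle (toℕ (u e))

  class-closed-neighbourhood : ∀ k d → d ≡ packing k ⊎ CAdj G d (packing k) → class d ≡ toℕ k
  class-closed-neighbourhood F.zero    _ (inj₁ refl) = refl
  class-closed-neighbourhood F.zero    (inj₁ F.zero) (inj₂ (centre≢centre , _)) = contradiction refl centre≢centre
  class-closed-neighbourhood F.zero    (inj₁ (F.suc _)) (inj₂ (_ , ()))
  class-closed-neighbourhood F.zero    (inj₂ _) (inj₂ (inj₁ refl)) = refl
  class-closed-neighbourhood F.zero    (inj₂ (edge _ _ () _)) (inj₂ (inj₂ refl))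
  class-closed-neighbourhood (F.suc i) _ (inj₁ refl) = triangle-tip₁ i
  class-closed-neighbourhood (F.suc i) (inj₁ _) (inj₂ (inj₁ refl)) = triangle-tip₁ i
  class-closed-neighbourhood (F.suc i) (inj₁ _) (inj₂ (inj₂ refl)) = triangle-tip₂ i

open FriendshipCentral

theorem4p6 : (n : ℕ) → 2 ≤ n → DominationNumber (central (friendship n)) (suc n)
theorem4p6 n 2≤n =
  ( anchors n
  , tabulate⁺ (anchor-injective n ∘ inj₁-injective)
  , anchors-dominate n 2≤n
  , length-tabulate (inj₁ ∘ anchor n) )
  , packing≤dominating (central (friendship n)) (packing n) (class n) (class-closed-neighbourhood n)
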